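{- Let $\mathfrak{n}$ be a Hoffman graph and suppose $\mathfrak{n}=\bigoplus_{i=0}^k\mathfrak{n}^i=\bigoplus_{i=0}^l\mathfrak{m}^i$ for non-empty indecomposable Hoffman graphs $\mathfrak{n}^0,\dots,\mathfrak{n}^k,\mathfrak{m}^0,\dots,\mathfrak{m}^l$. Then $k=l$ and there is a permutation $\sigma$ of $\{0,1,\dots,k\}$ such that $\mathfrak{n}^i=\mathfrak{m}^{\sigma(i)}$ for each $i$.
   Context: All graphs are finite, simple and undirected. A Hoffman graph $\mathfrak{h}=(H,\mu)$ is a graph $H$ with a labeling $\mu:V(H)\to\{f,s\}$ such that every fat vertex (label $f$) is adjacent to at least one slim vertex (label $s$), and fat vertices are pairwise non-adjacent. $V_s(\mathfrak{h})$, $V_f(\mathfrak{h})$ denote the slim and fat vertex sets, $N^f_{\mathfrak{h}}(x)$ the set of fat neighbours of $x$, and $x\sim y$ adjacency. A Hoffman subgraph is an induced subgraph with restricted labeling. Sum: for Hoffman subgraphs $\mathfrak{h}^1,\dots,\mathfrak{h}^k$ of $\mathfrak{h}$, $\mathfrak{h}=\bigoplus_i\mathfrak{h}^i$ means (i) $V(\mathfrak{h})=\bigcup_iV(\mathfrak{h}^i)$; (ii) $V_s(\mathfrak{h})$ is the disjoint union of the $V_s(\mathfrak{h}^i)$; (iii) $N^f_{\mathfrak{h}^i}(x)=N^f_{\mathfrak{h}}(x)$ for $x\in V_s(\mathfrak{h}^i)$; (iv) for $x\in V_s(\mathfrak{h}^i)$, $y\in V_s(\mathfrak{h}^j)$,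 $i\ne j$: $|N^f_{\mathfrak{h}}(x)\cap N^f_{\mathfrak{h}}(y)|\le1$ with equality iff $x\sim y$. $\mathfrak{h}$ is decomposable if it is the sum of two non-empty Hoffman subgraphs, and indecomposable otherwise. -}

module Defs where

open import Data.Nat using (ℕ)
open import Data.Fin using (Fin)
open import Data.Fin.Subset using (Subset; _∈_; _⊆_)
open import Data.Product using (Σ; ∃; _×_; _,_)
open import Relation.Binary.PropositionalEquality using (_≡_; _≢_)
open import Relation.Nullary using (¬_)
open import Function.Bundles using (_⇔_)
open import Level using (0ℓ)

data Label : Set where
  fat slim : Label

record HoffmanGraph (n : ℕ) : Set₁ where
  field
    _~_     : Fin n → Fin n → Set
    ~-sym   : ∀ {x y} → x ~ y → y ~ x
    ~-irr   : ∀ {x} → ¬ (x ~ x)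
    μ       : Fin n → Label
    fat-indep : ∀ {x y} → μ x ≡ fat → μ y ≡ fat → ¬ (x ~ y)
    fat-has-slim : ∀ x → μ x ≡ fat → ∃ λ y → μ y ≡ slim × x ~ y

module _ {n : ℕ} (H : HoffmanGraph n) where
  open HoffmanGraph H

  IsHoffmanSubgraph : Subset n → Set
  IsHoffmanSubgraph U =
    ∀ x → x ∈ U → μ x ≡ fat → ∃ λ y → y ∈ U × μ y ≡ slim × x ~ y

  FatNbr : Subset n → Fin n → Fin n → Set
  FatNbr U x f = f ∈ U × μ f ≡ fat × x ~ f

  NonEmpty : Subset n → Set
  NonEmpty U = ∃ λ v → v ∈ U

  record IsSum (U : Subset n) (m : ℕ) (S : Fin m → Subset n) : Set where
    field
      sub     : ∀ i → S i ⊆ U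
      hoff    : ∀ i → IsHoffmanSubgraph (S i)
      cover   : ∀ v → v ∈ U → ∃ λ i → v ∈ S i
      -- (ii) slim vertex sets are disjoint (union is implied by cover)
      disjoint : ∀ i j x → μ x ≡ slim → x ∈ S i → x ∈ S j → i ≡ j
      fatClosed : ∀ i x → μ x ≡ slim → x ∈ S i → ∀ f → FatNbr U x f → f ∈ S i
      atMostOne : ∀ i j → i ≢ j → ∀ x y → μ x ≡ slim → μ y ≡ slim →
                  x ∈ S i → y ∈ S j →
                  ∀ f g → FatNbr U x f → FatNbr U y f →
                  FatNbr U x g → FatNbr U y g → f ≡ g
      oneIff  : ∀ i j → i ≢ j → ∀ x y → μ x ≡ slim → μ y ≡ slim →
                x ∈ S i → y ∈ S j →
                (x ~ y) ⇔ (∃ λ f → FatNbr U x f × FatNbr U y f)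

  Decomposable : Subset n → Set
  Decomposable U = Σ (Fin 2 → Subset n) λ S → IsSum U 2 S × (∀ i → NonEmpty (S i))

  Indecomposable : Subset n → Set
  Indecomposable U = ¬ Decomposable U

module Submission where

-- The heart of the proof is the observation that an indecomposable summand
-- cannot be split by another sum decomposition: if U is an indecomposable
-- Hoffman subgraph that contains the fat neighbours of its slim vertices, and
-- S is any sum decomposition of the whole graph, then U lies inside a single
-- part of S (⊆-part).  To see this we show that every colouring of the slim
-- vertices which is constant on the parts of S induces a sum decomposition
-- of U (module Coarsening): a fat vertex joins the colour classes of its
-- slim neighbours.  Colouring by membership in one part of S, two slim
-- vertices of U in different parts would give a decomposition of U into two
-- non-empty pieces.  Building these pieces requires deciding adjacency;
-- since the conclusion is a decidable equation of part indices, classical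
-- decidability of the (finite) adjacency relation may be assumed.
--
-- Given two decompositions N and M into indecomposables, every N i thus lies
-- in some M (σ i) and every M j in some N (τ j); comparing a slim vertex of
-- each summand shows that σ and τ are mutually inverse, so they form a
-- permutation, k ≡ l, and N i ≡ M (σ i) by antisymmetry of inclusion.

open import Defs
open import Data.Nat using (ℕ; suc)
open import Data.Nat.Properties using (suc-injective)
open import Data.Fin using (Fin; zero; suc; _≟_)
open import Data.Fin.Properties using (any?)
open import Data.Fin.Subset using (Subset; ⊤; _∈_; _⊆_)
open import Data.Fin.Subset.Properties using (_∈?_; ∈⊤; ⊆-antisym)
open import Data.Fin.Permutation using (Permutation; _⟨$⟩ʳ_; permutation; ↔⇒≡)
open import Data.Bool using (true)
open import Data.Product using (Σ; ∃; _×_; _,_; proj₁; proj₂)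
open import Data.Sum using (_⊎_; inj₁; inj₂)
open import Data.Empty using (⊥-elim)
open import Data.Vec using (tabulate)
open import Data.Vec.Properties using (lookup∘tabulate; lookup⇒[]=; []=⇒lookup)
open import Function.Bundles using (mk⇔; Equivalence)
open import Relation.Binary.PropositionalEquality
  using (_≡_; _≢_; refl; sym; trans; subst)
open import Relation.Nullary using (¬_; Dec; yes; no; does)
open import Relation.Nullary.Decidable
  using (_×-dec_; _⊎-dec_; decidable-stable; ¬¬-excluded-middle; dec-true)

⟦_⟧ : ∀ {n} {P : Fin n → Set} → (∀ z → Dec (P z)) → Subset n
⟦ P? ⟧ = tabulate (λ z → does (P? z))

∈⟦⟧⁺ : ∀ {n} {P : Fin n → Set} (P? : ∀ z → Dec (P z)) {z} → P z → z ∈ ⟦ P? ⟧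
∈⟦⟧⁺ P? {z} p =
  lookup⇒[]= z _ (trans (lookup∘tabulate (λ z → does (P? z)) z) (dec-true (P? z) p))

∈⟦⟧⁻ : ∀ {n} {P : Fin n → Set} (P? : ∀ z → Dec (P z)) {z} → z ∈ ⟦ P? ⟧ → P z
∈⟦⟧⁻ P? {z} z∈ = witness (P? z) (trans (sym (lookup∘tabulate _ z)) ([]=⇒lookup z∈))
  where
  witness : ∀ {A : Set} (a? : Dec A) → does a? ≡ true → A
  witness (yes a) _  = a
  witness (no _)  ()

-- Double negation commutes with finite products: needed to assume the
-- decidability of all (finitely many) adjacencies at once.
¬¬-∀-Fin : ∀ m {P : Fin m → Set} → (∀ i → ¬ ¬ P i) → ¬ ¬ (∀ i → P i)
¬¬-∀-Fin ℕ.zero    _    k = k (λ ())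
¬¬-∀-Fin (suc m) ¬¬P k = ¬¬P zero λ p₀ →
  ¬¬-∀-Fin m (λ i → ¬¬P (suc i)) λ ps → k λ { zero → p₀ ; (suc i) → ps i }

_≟ℓ_ : (a b : Label) → Dec (a ≡ b)
fat  ≟ℓ fat  = yes refl
fat  ≟ℓ slim = no (λ ())
slim ≟ℓ fat  = no (λ ())
slim ≟ℓ slim = yes refl

module _ {n : ℕ} (H : HoffmanGraph n) where
  open HoffmanGraph H

  slim≢fat : ∀ {z} → μ z ≡ slim → μ z ≢ fat
  slim≢fat s f with trans (sym s) f
  ... | ()

  slim-or-fat : ∀ z → μ z ≡ slim ⊎ μ z ≡ fat
  slim-or-fat z with μ z
  ... | slim = inj₁ refl
  ... | fat  = inj₂ refl

  -- U contains all fat neighbours (in the whole graph) of its slim vertices;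
  -- this holds for every summand of a sum decomposition of the whole graph.
  FatClosed : Subset n → Set
  FatClosed U = ∀ x → μ x ≡ slim → x ∈ U → ∀ f → FatNbr H ⊤ x f → f ∈ U

  slim-witness : ∀ {U} → IsHoffmanSubgraph H U → NonEmpty H U →
                 ∃ λ x → μ x ≡ slim × x ∈ U
  slim-witness hoffU (v , v∈U) with slim-or-fat v
  ... | inj₁ sv = v , sv , v∈U
  ... | inj₂ fv = let (w , w∈U , sw , _) = hoffU v v∈U fv in w , sw , w∈U

  ¬¬-adjacency-decidable : ¬ ¬ (∀ x y → Dec (x ~ y))
  ¬¬-adjacency-decidable =
    ¬¬-∀-Fin n (λ x → ¬¬-∀-Fin n (λ y → ¬¬-excluded-middle))

  -- A colouring c of the slim vertices that is constant on each part of a sum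
  -- decomposition S of the whole graph induces a sum decomposition T of any
  -- fat-closed Hoffman subgraph U: T i consists of the slim vertices of U of
  -- colour i together with their fat neighbours.
  module Coarsening {U : Subset n} (hoffU : IsHoffmanSubgraph H U)
    (closedU : FatClosed U)
    {p : ℕ} {S : Fin p → Subset n} (sumS : IsSum H ⊤ p S)
    {m : ℕ} (c : Fin n → Fin m)
    (c-const : ∀ q x y → μ x ≡ slim → μ y ≡ slim → x ∈ S q → y ∈ S q → c x ≡ c y)
    (_~?_ : ∀ x y → Dec (x ~ y)) where
    private module S = IsSum sumS

    Member : Fin m → Fin n → Set
    Member i z = z ∈ U ×
      ((μ z ≡ slim × c z ≡ i) ⊎
       (μ z ≡ fat × ∃ λ w → w ∈ U × μ w ≡ slim × c w ≡ i × z ~ w))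

    member? : ∀ i z → Dec (Member i z)
    member? i z = (z ∈? U) ×-dec
      (((μ z ≟ℓ slim) ×-dec (c z ≟ i)) ⊎-dec
       ((μ z ≟ℓ fat) ×-dec any? λ w →
          (w ∈? U) ×-dec (μ w ≟ℓ slim) ×-dec (c w ≟ i) ×-dec (z ~? w)))

    T : Fin m → Subset n
    T i = ⟦ member? i ⟧

    slim∈T : ∀ {x} → μ x ≡ slim → x ∈ U → x ∈ T (c x)
    slim∈T sx x∈U = ∈⟦⟧⁺ (member? _) (x∈U , inj₁ (sx , refl))

    T⊆U : ∀ i → T i ⊆ U
    T⊆U i z∈T = proj₁ (∈⟦⟧⁻ (member? i) z∈T)

    colour : ∀ {i x} → μ x ≡ slim → x ∈ T i → c x ≡ i
    colour {i} sx x∈T with ∈⟦⟧⁻ (member? i) x∈T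
    ... | _ , inj₁ (_ , cx≡i) = cx≡i
    ... | _ , inj₂ (fx , _)   = ⊥-elim (slim≢fat sx fx)

    apart : ∀ {i j x y q r} → i ≢ j → μ x ≡ slim → μ y ≡ slim →
            x ∈ T i → y ∈ T j → x ∈ S q → y ∈ S r → q ≢ r
    apart {q = q} i≢j sx sy x∈T y∈T x∈S y∈S refl =
      i≢j (trans (sym (colour sx x∈T)) (trans (c-const q _ _ sx sy x∈S y∈S) (colour sy y∈T)))

    narrow : ∀ {x f} → μ x ≡ slim → x ∈ U → FatNbr H ⊤ x f → FatNbr H U x f
    narrow {x} {f} sx x∈U (f∈⊤ , ff , x~f) = closedU x sx x∈U f (f∈⊤ , ff , x~f) , ff , x~f

    widen : ∀ {x f} → FatNbr H U x f → FatNbr H ⊤ x f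
    widen (_ , ff , x~f) = ∈⊤ , ff , x~f

    hoffT : ∀ i → IsHoffmanSubgraph H (T i)
    hoffT i z z∈T fz with ∈⟦⟧⁻ (member? i) z∈T
    ... | _ , inj₁ (sz , _) = ⊥-elim (slim≢fat sz fz)
    ... | _ , inj₂ (_ , w , w∈U , sw , cw≡i , z~w) =
      w , ∈⟦⟧⁺ (member? i) (w∈U , inj₁ (sw , cw≡i)) , sw , z~w

    coverT : ∀ v → v ∈ U → ∃ λ i → v ∈ T i
    coverT v v∈U with slim-or-fat v
    ... | inj₁ sv = c v , slim∈T sv v∈U
    ... | inj₂ fv = let (w , w∈U , sw , v~w) = hoffU v v∈U fv in
      c w , ∈⟦⟧⁺ (member? _) (v∈U , inj₂ (fv , w , w∈U , sw , refl , v~w))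

    T-isSum : IsSum H U m T
    T-isSum = record
      { sub       = T⊆U
      ; hoff      = hoffT
      ; cover     = coverT
      ; disjoint  = λ i j x sx x∈Ti x∈Tj → trans (sym (colour sx x∈Ti)) (colour sx x∈Tj)
      ; fatClosed = λ i x sx x∈T f (f∈U , ff , x~f) →
          ∈⟦⟧⁺ (member? i) (f∈U , inj₂ (ff , x , T⊆U i x∈T , sx , colour sx x∈T , ~-sym x~f))
      ; atMostOne = λ i j i≢j x y sx sy x∈T y∈T f g xf yf xg yg →
          let (q , x∈S) = S.cover x ∈⊤ ; (r , y∈S) = S.cover y ∈⊤ in
          S.atMostOne q r (apart i≢j sx sy x∈T y∈T x∈S y∈S) x y sx sy x∈S y∈S f g
            (widen xf) (widen yf) (widen xg) (widen yg)
      ; oneIff    = λ i j i≢j x y sx sy x∈T y∈T →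
          let (q , x∈S) = S.cover x ∈⊤ ; (r , y∈S) = S.cover y ∈⊤
              x~y⇔ = S.oneIff q r (apart i≢j sx sy x∈T y∈T x∈S y∈S) x y sx sy x∈S y∈S in
          mk⇔ (λ x~y → let (f , xf , yf) = Equivalence.to x~y⇔ x~y in
                 f , narrow sx (T⊆U i x∈T) xf , narrow sy (T⊆U j y∈T) yf)
              (λ (f , xf , yf) → Equivalence.from x~y⇔ (f , widen xf , widen yf))
      }

  module _ {U : Subset n} (hoffU : IsHoffmanSubgraph H U) (closedU : FatClosed U)
    (indecU : Indecomposable H U) {p : ℕ} {S : Fin p → Subset n}
    (sumS : IsSum H ⊤ p S) where
    private module S = IsSum sumS

    -- All slim vertices of U lie in the same part of S: colouring by
    -- membership in S a, slim vertices in S a and in S b with b ≢ a would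
    -- decompose U.
    same-part : ∀ {a b x y} → μ x ≡ slim → μ y ≡ slim → x ∈ U → y ∈ U →
                x ∈ S a → y ∈ S b → a ≡ b
    same-part {a} {b} {x} {y} sx sy x∈U y∈U x∈Sa y∈Sb =
      decidable-stable (a ≟ b) λ a≢b → ¬¬-adjacency-decidable λ _~?_ →
        let open Coarsening hoffU closedU sumS inSa? inSa?-const _~?_ in
        indecU (T , T-isSum , λ
          { zero       → x , subst (λ i → x ∈ T i) (inSa?-in x∈Sa) (slim∈T sx x∈U)
          ; (suc zero) → y , subst (λ i → y ∈ T i) (inSa?-out a≢b) (slim∈T sy y∈U) })
      where
      inSa? : Fin n → Fin 2
      inSa? z with z ∈? S a
      ... | yes _ = zero
      ... | no _  = suc zero

      inSa?-in : ∀ {z} → z ∈ S a → inSa? z ≡ zero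
      inSa?-in {z} z∈Sa with z ∈? S a
      ... | yes _   = refl
      ... | no z∉Sa = ⊥-elim (z∉Sa z∈Sa)

      inSa?-out : a ≢ b → inSa? y ≡ suc zero
      inSa?-out a≢b with y ∈? S a
      ... | yes y∈Sa = ⊥-elim (a≢b (S.disjoint a b y sy y∈Sa y∈Sb))
      ... | no _     = refl

      inSa?-const : ∀ q z w → μ z ≡ slim → μ w ≡ slim → z ∈ S q → w ∈ S q →
                    inSa? z ≡ inSa? w
      inSa?-const q z w sz sw z∈Sq w∈Sq with z ∈? S a | w ∈? S a
      ... | yes _    | yes _    = refl
      ... | no _     | no _     = refl
      ... | yes z∈Sa | no w∉Sa  =
        ⊥-elim (w∉Sa (subst (λ r → w ∈ S r) (S.disjoint q a z sz z∈Sq z∈Sa) w∈Sq))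
      ... | no z∉Sa  | yes w∈Sa =
        ⊥-elim (z∉Sa (subst (λ r → z ∈ S r) (S.disjoint q a w sw w∈Sq w∈Sa) z∈Sq))

    slim⊆part : ∀ {a x w} → μ x ≡ slim → x ∈ U → x ∈ S a →
                μ w ≡ slim → w ∈ U → w ∈ S a
    slim⊆part {a} {w = w} sx x∈U x∈Sa sw w∈U = let (b , w∈Sb) = S.cover w ∈⊤ in
      subst (λ r → w ∈ S r) (same-part sw sx w∈U x∈U w∈Sb x∈Sa) w∈Sb

    -- Fat vertices of U follow a slim neighbour in U, by fat-closedness of S a.
    ⊆-part : ∀ {a x} → μ x ≡ slim → x ∈ U → x ∈ S a → U ⊆ S a
    ⊆-part {a} sx x∈U x∈Sa {z} z∈U with slim-or-fat z
    ... | inj₁ sz = slim⊆part sx x∈U x∈Sa sz z∈U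
    ... | inj₂ fz = let (w , w∈U , sw , z~w) = hoffU z z∈U fz in
      S.fatClosed a w sw (slim⊆part sx x∈U x∈Sa sw w∈U) z (∈⊤ , fz , ~-sym z~w)

  module Matching {p q : ℕ} {A : Fin p → Subset n} {B : Fin q → Subset n}
    (sumA : IsSum H ⊤ p A) (sumB : IsSum H ⊤ q B)
    (indecA : ∀ i → NonEmpty H (A i) × Indecomposable H (A i)) where
    private
      module A = IsSum sumA
      module B = IsSum sumB

    slim-of : ∀ i → ∃ λ x → μ x ≡ slim × x ∈ A i
    slim-of i = slim-witness (A.hoff i) (proj₁ (indecA i))

    σ : Fin p → Fin q
    σ i = proj₁ (B.cover (proj₁ (slim-of i)) ∈⊤)

    A⊆Bσ : ∀ i → A i ⊆ B (σ i)
    A⊆Bσ i = let (x , sx , x∈A) = slim-of i in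
      ⊆-part (A.hoff i) (A.fatClosed i) (proj₂ (indecA i)) sumB sx x∈A
        (proj₂ (B.cover x ∈⊤))

    -- If moreover each B j lies in A (τ j), then τ undoes σ: the slim vertex
    -- of A i lies in A (τ (σ i)) as well, and slim vertices lie in one part.
    τ∘σ≡id : (τ : Fin q → Fin p) → (∀ j → B j ⊆ A (τ j)) → ∀ i → τ (σ i) ≡ i
    τ∘σ≡id τ B⊆Aτ i = let (x , sx , x∈A) = slim-of i in
      sym (A.disjoint i (τ (σ i)) x sx x∈A (B⊆Aτ (σ i) (A⊆Bσ i x∈A)))

lemma3p1 : ∀ {n : ℕ} (H : HoffmanGraph n) (k l : ℕ)
    (N : Fin (suc k) → Subset n) (M : Fin (suc l) → Subset n) →
    IsSum H ⊤ (suc k) N → IsSum H ⊤ (suc l) M →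
    (∀ i → NonEmpty H (N i) × Indecomposable H (N i)) →
    (∀ j → NonEmpty H (M j) × Indecomposable H (M j)) →
    k ≡ l × Σ (Permutation (suc k) (suc l)) (λ σ → ∀ i → N i ≡ M (σ ⟨$⟩ʳ i))
lemma3p1 H k l N M sumN sumM indecN indecM =
  suc-injective (↔⇒≡ π) , π , N≡Mπ
  where
  module NM = Matching H sumN sumM indecN
  module MN = Matching H sumM sumN indecM

  π : Permutation (suc k) (suc l)
  π = permutation NM.σ MN.σ (MN.τ∘σ≡id NM.σ NM.A⊆Bσ) (NM.τ∘σ≡id MN.σ MN.A⊆Bσ)

  N≡Mπ : ∀ i → N i ≡ M (π ⟨$⟩ʳ i)
  N≡Mπ i = ⊆-antisym (NM.A⊆Bσ i)
    (λ z∈M → subst (λ r → _ ∈ N r) (NM.τ∘σ≡id MN.σ MN.A⊆Bσ i) (MN.A⊆Bσ (NM.σ i) z∈M))
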